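{- Let $Q\in M_{n,r}(\mathbb{C})$ have at least one non-zero entry. Then there exists a line (row or column) of the board $S(Q)$ that contains exactly one green square and such that the board obtained from $S(Q)$ by deleting this line coincides with the board obtained from $S_0(Q)$ by deleting this line and then performing steps (O1), (O2), (O3).
   Context: For $Q\in M_{n,r}(\mathbb{C})$, $S_0(Q)$ is the $n\times r$ board with black squares at zero entries of $Q$ and white squares at nonzero entries. (O1) For each column, color blue the first white square from top to bottom, giving $S_1(Q)$. (O2) For each row of $S_1(Q)$, color red the first white (uncolored) square from left to right, giving $S_2(Q)$. (O3) Color green each blue or red square of $S_2(Q)$, giving $S(Q)$. For a board obtained by deleting a line from $S_0(Q)$, the steps (O1)–(O3) are applied to that smaller board in the same way. -}

module Defs where

open import Data.Nat using (ℕ; zero; suc; _+_; pred)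
open import Data.Bool using (Bool; true; false; not; _∧_; if_then_else_)
open import Data.Fin using (Fin; zero; suc; punchIn)
open import Relation.Nullary using (does)
open import Relation.Binary.Definitions using (DecidableEquality)

data Color : Set where
  black white blue red green : Color

-- An n × r board (rows indexed by Fin n, top to bottom; columns by Fin r,
-- left to right).
Board : ℕ → ℕ → Set
Board n r = Fin n → Fin r → Color

isWhite : Color → Bool
isWhite white = true
isWhite _     = false

isGreen : Color → Bool
isGreen green = true
isGreen _     = false

firstTrue : ∀ {m} → (Fin m → Bool) → Fin m → Bool
firstTrue f zero    = f zero
firstTrue f (suc i) = not (f zero) ∧ firstTrue (λ k → f (suc k)) i

count : ∀ {m} → (Fin m → Bool) → ℕ
count {zero}  f = 0
count {suc m} f = (if f zero then 1 else 0) + count (λ k → f (suc k))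

S₀ : {A : Set} → A → DecidableEquality A → ∀ {n r} → (Fin n → Fin r → A) → Board n r
S₀ 0# _≟_ Q i j = if does (Q i j ≟ 0#) then black else white

O1 : ∀ {n r} → Board n r → Board n r
O1 B i j = if firstTrue (λ k → isWhite (B k j)) i then blue else B i j

O2 : ∀ {n r} → Board n r → Board n r
O2 B i j = if firstTrue (λ k → isWhite (B i k)) j then red else B i j

O3col : Color → Color
O3col blue = green
O3col red  = green
O3col c    = c

O3 : ∀ {n r} → Board n r → Board n r
O3 B i j = O3col (B i j)

S : ∀ {n r} → Board n r → Board n r
S B = O3 (O2 (O1 B))

deleteRow : ∀ {n r} → Fin n → Board n r → Board (pred n) r
deleteRow {suc n} i B k j = B (punchIn i k) j

deleteCol : ∀ {n r} → Fin r → Board n r → Board n (pred r)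
deleteCol {r = suc r} j B i k = B i (punchIn j k)

greensInRow : ∀ {n r} → Board n r → Fin n → ℕ
greensInRow B i = count (λ j → isGreen (B i j))

greensInCol : ∀ {n r} → Board n r → Fin r → ℕ
greensInCol B j = count (λ i → isGreen (B i j))

module Submission where

-- Call a board *plain* if it has no blue, red or green square
-- (every S₀(Q) is plain).  For a plain board B we single out two kinds of
-- removable lines:
--   * a row that contains a white square but no first white square of any
--     column (so (O1) colours nothing in it): in S(B) its only green square
--     is the red one, and deleting it changes (O1) in no other row;
--   * a column that contains exactly one white square (its first one):
--     in S(B) its only green square is the blue one, and since (O1) leaves
--     no white square in it, deleting it changes (O2) in no row.
-- Existence: let i be the LAST row containing a white square.  If no column
-- has its first white square in row i, row i is removable; otherwise such a
-- column j has no white square above row i (by firstness) nor below it (by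
-- lastness), so column j is removable.

open import Defs
open import Data.Nat using (ℕ; pred; zero; suc; s≤s; _+_)
open import Data.Fin using (Fin; zero; suc; punchIn; _<_)
open import Data.Fin.Properties using (any?; <-cmp)
open import Data.Bool using (Bool; true; false; not; _∧_; if_then_else_)
open import Data.Bool.Properties using (¬-not; not-¬) renaming (_≟_ to _≟ᵇ_)
open import Data.Product using (Σ; ∃; ∃₂; _×_; _,_)
open import Data.Sum using (_⊎_; inj₁; inj₂)
open import Data.Empty using (⊥-elim)
open import Relation.Nullary using (¬_; yes; no; does)
open import Relation.Unary using (Pred; Decidable)
open import Relation.Binary using (tri<; tri≈; tri>)
open import Relation.Binary.PropositionalEquality
  using (_≡_; _≢_; refl; sym; trans; cong; cong₂)
open import Relation.Binary.Definitions using (DecidableEquality)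

lastWitness : ∀ {m p} (P : Pred (Fin m) p) → Decidable P → ∃ P →
              ∃ λ i → P i × (∀ k → i < k → ¬ P k)
lastWitness {suc m} P P? (i , pi) with any? (λ k → P? (suc k))
... | yes later with lastWitness (λ k → P (suc k)) (λ k → P? (suc k)) later
...   | i′ , pi′ , none = suc i′ , pi′ , λ { (suc k) (s≤s i′<k) → none k i′<k }
lastWitness {suc m} P P? (zero , p0) | no ¬later = zero , p0 , λ { (suc k) _ pk → ¬later (k , pk) }
lastWitness {suc m} P P? (suc i , pi) | no ¬later = ⊥-elim (¬later (i , pi))

firstTrue-cong : ∀ {m} {f g : Fin m → Bool} → (∀ x → f x ≡ g x) →
                 ∀ i → firstTrue f i ≡ firstTrue g i
firstTrue-cong f≗g zero    = f≗g zero
firstTrue-cong f≗g (suc i) =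
  cong₂ (λ a b → not a ∧ b) (f≗g zero) (firstTrue-cong (λ x → f≗g (suc x)) i)

firstTrue-false : ∀ {m} (f : Fin m → Bool) i → f i ≡ false → firstTrue f i ≡ false
firstTrue-false f zero    fi = fi
firstTrue-false f (suc i) fi with f zero
... | true  = refl
... | false = firstTrue-false (λ x → f (suc x)) i fi

firstTrue⇒true : ∀ {m} (f : Fin m → Bool) i → firstTrue f i ≡ true → f i ≡ true
firstTrue⇒true f i first with f i in fi
... | true  = refl
... | false = ⊥-elim (not-¬ first (firstTrue-false f i fi))

firstTrue-before : ∀ {m} (f : Fin m → Bool) i k → firstTrue f i ≡ true → k < i → f k ≡ false
firstTrue-before f (suc i) zero    first _ with f zero
... | true  = ⊥-elim (not-¬ first refl)
... | false = refl
firstTrue-before f (suc i) (suc k) first (s≤s k<i) with f zero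
... | true  = ⊥-elim (not-¬ first refl)
... | false = firstTrue-before (λ x → f (suc x)) i k first k<i

firstTrue-punchIn : ∀ {m} (f : Fin (suc m) → Bool) i → firstTrue f i ≡ false →
                    ∀ k → firstTrue (λ x → f (punchIn i x)) k ≡ firstTrue f (punchIn i k)
firstTrue-punchIn f zero    notFirst k rewrite notFirst = refl
firstTrue-punchIn f (suc i) notFirst zero = refl
firstTrue-punchIn {suc m} f (suc i) notFirst (suc k) with f zero
... | true  = refl
... | false = firstTrue-punchIn (λ x → f (suc x)) i notFirst k

count-cong : ∀ {m} {f g : Fin m → Bool} → (∀ x → f x ≡ g x) → count f ≡ count g
count-cong {zero}  f≗g = refl
count-cong {suc m} f≗g =
  cong₂ (λ a b → (if a then 1 else 0) + b) (f≗g zero) (count-cong (λ x → f≗g (suc x)))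

count-none : ∀ m → count {m} (λ _ → false) ≡ 0
count-none zero    = refl
count-none (suc m) = count-none m

count-firstTrue : ∀ {m} (f : Fin m → Bool) x → f x ≡ true → count (firstTrue f) ≡ 1
count-firstTrue {suc m} f x fx with f zero in f0
... | true  = cong suc (count-none m)
... | false with x
...   | zero   = ⊥-elim (not-¬ fx f0)
...   | suc x′ = count-firstTrue (λ k → f (suc k)) x′ fx

green-iff-marked : ∀ b d {c} → isGreen (O3col d) ≡ true → isGreen (O3col c) ≡ false →
                   isGreen (O3col (if b then d else c)) ≡ b
green-iff-marked true  d dGreen cPlain = dGreen
green-iff-marked false d dGreen cPlain = cPlain

Plain : ∀ {n r} → Board n r → Set
Plain B = ∀ i j → isGreen (O3col (B i j)) ≡ false

module RemovableLines {n r : ℕ} (B : Board n r) where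

  colWhite : Fin r → Fin n → Bool
  colWhite j k = isWhite (B k j)

  RowRemovable : Fin n → Set
  RowRemovable i = (∃ λ x → isWhite (B i x) ≡ true) × (∀ j → firstTrue (colWhite j) i ≡ false)

  ColRemovable : Fin r → Set
  ColRemovable j = (∃ λ x → isWhite (B x j) ≡ true) ×
                   (∀ k → isWhite (B k j) ≡ true → firstTrue (colWhite j) k ≡ true)

  O1-removableRow : ∀ {i} → RowRemovable i → ∀ j → O1 B i j ≡ B i j
  O1-removableRow {i} (_ , noBlue) j rewrite noBlue j = refl

  O1-removableCol : ∀ {j} → ColRemovable j → ∀ k → isWhite (O1 B k j) ≡ false
  O1-removableCol {j} (_ , onlyFirst) k with firstTrue (colWhite j) k in first
  ... | true  = refl
  ... | false with isWhite (B k j) in whiteK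
  ...   | true  = ⊥-elim (not-¬ (onlyFirst k whiteK) first)
  ...   | false = refl

  module _ (plain : Plain B) where

    rowGreens : ∀ i → RowRemovable i → greensInRow (S B) i ≡ 1
    rowGreens i removable@((x , whiteX) , _) =
      trans (count-cong greenIffRed)
            (count-firstTrue (λ l → isWhite (O1 B i l)) x
                             (trans (cong isWhite (O1-removableRow removable x)) whiteX))
      where
      greenIffRed : ∀ j → isGreen (S B i j) ≡ firstTrue (λ l → isWhite (O1 B i l)) j
      greenIffRed j rewrite O1-removableRow removable j =
        green-iff-marked (firstTrue (λ l → isWhite (O1 B i l)) j) red refl (plain i j)

    colGreens : ∀ j → ColRemovable j → greensInCol (S B) j ≡ 1
    colGreens j removable@((x , whiteX) , _) =
      trans (count-cong greenIffBlue) (count-firstTrue (colWhite j) x whiteX)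
      where
      greenIffBlue : ∀ k → isGreen (S B k j) ≡ firstTrue (colWhite j) k
      greenIffBlue k
        rewrite firstTrue-false (λ l → isWhite (O1 B k l)) j (O1-removableCol removable k) =
        green-iff-marked (firstTrue (colWhite j) k) blue refl (plain k j)

  removableLine : (∃₂ λ i j → isWhite (B i j) ≡ true) → (∃ RowRemovable) ⊎ (∃ ColRemovable)
  removableLine (i₀ , white₀)
    with lastWitness (λ i → ∃ λ j → isWhite (B i j) ≡ true)
                     (λ i → any? (λ j → isWhite (B i j) ≟ᵇ true)) (i₀ , white₀)
  ... | i , whiteInRow , noneBelow with any? (λ j → firstTrue (colWhite j) i ≟ᵇ true)
  ...   | no noBlue = inj₁ (i , whiteInRow , λ j → ¬-not (λ first → noBlue (j , first)))
  ...   | yes (j , first) = inj₂ (j , (i , firstTrue⇒true (colWhite j) i first) , onlyFirst)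
    where
    onlyFirst : ∀ k → isWhite (B k j) ≡ true → firstTrue (colWhite j) k ≡ true
    onlyFirst k whiteK with <-cmp k i
    ... | tri< k<i _ _ = ⊥-elim (not-¬ whiteK (firstTrue-before (colWhite j) i k first k<i))
    ... | tri≈ _ refl _ = first
    ... | tri> _ _ i<k = ⊥-elim (noneBelow k i<k (j , whiteK))

open RemovableLines

-- Deleting a removable row commutes with (O1)–(O3): (O1) is unchanged on the
-- other rows, hence so are (O2) and (O3).
deleteRow-S : ∀ {n r} (B : Board (suc n) r) i → RowRemovable B i →
              ∀ k j → deleteRow i (S B) k j ≡ S (deleteRow i B) k j
deleteRow-S B i (_ , noBlue) k j = sym (cong O3col O2-agrees)
  where
  O1-agrees : ∀ l → O1 (deleteRow i B) k l ≡ O1 B (punchIn i k) l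
  O1-agrees l = cong (λ b → if b then blue else B (punchIn i k) l)
                     (firstTrue-punchIn (colWhite B l) i (noBlue l) k)
  O2-agrees : O2 (O1 (deleteRow i B)) k j ≡ O2 (O1 B) (punchIn i k) j
  O2-agrees = cong₂ (λ b c → if b then red else c)
                    (firstTrue-cong (λ l → cong isWhite (O1-agrees l)) j) (O1-agrees j)

-- Deleting a removable column commutes with (O1)–(O3): (O1) acts column by
-- column, and the deleted column holds no white square after (O1), so (O2)
-- picks the same square in every row.
deleteCol-S : ∀ {n r} (B : Board n (suc r)) j → ColRemovable B j →
              ∀ i k → deleteCol j (S B) i k ≡ S (deleteCol j B) i k
deleteCol-S B j removable i k =
  sym (cong (λ b → O3col (if b then red else O1 B i (punchIn j k)))
            (firstTrue-punchIn (λ l → isWhite (O1 B i l)) j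
               (firstTrue-false (λ l → isWhite (O1 B i l)) j (O1-removableCol B removable i)) k))

plainS₀ : {A : Set} (0# : A) (_≟_ : DecidableEquality A) {n r : ℕ} (Q : Fin n → Fin r → A) →
          Plain (S₀ 0# _≟_ Q)
plainS₀ 0# _≟_ Q i j with does (Q i j ≟ 0#)
... | true  = refl
... | false = refl

whiteS₀ : {A : Set} (0# : A) (_≟_ : DecidableEquality A) {n r : ℕ} (Q : Fin n → Fin r → A) →
          ∀ i j → Q i j ≢ 0# → isWhite (S₀ 0# _≟_ Q i j) ≡ true
whiteS₀ 0# _≟_ Q i j nonzero with Q i j ≟ 0#
... | yes isZero = ⊥-elim (nonzero isZero)
... | no _     = refl

lemma2p5 : (A : Set) (0# : A) (_≟_ : DecidableEquality A)
           (n r : ℕ) (Q : Fin n → Fin r → A) →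
           (∃₂ λ i j → Q i j ≢ 0#) →
           (Σ (Fin n) λ i →
              greensInRow (S (S₀ 0# _≟_ Q)) i ≡ 1 ×
              (∀ (k : Fin (pred n)) (j : Fin r) →
                 deleteRow i (S (S₀ 0# _≟_ Q)) k j ≡ S (deleteRow i (S₀ 0# _≟_ Q)) k j))
           ⊎
           (Σ (Fin r) λ j →
              greensInCol (S (S₀ 0# _≟_ Q)) j ≡ 1 ×
              (∀ (i : Fin n) (k : Fin (pred r)) →
                 deleteCol j (S (S₀ 0# _≟_ Q)) i k ≡ S (deleteCol j (S₀ 0# _≟_ Q)) i k))
lemma2p5 A 0# _≟_ (suc n) (suc r) Q (i , j , nonzero)
  with removableLine (S₀ 0# _≟_ Q) (i , j , whiteS₀ 0# _≟_ Q i j nonzero)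
... | inj₁ (i′ , row) =
  inj₁ (i′ , rowGreens B (plainS₀ 0# _≟_ Q) i′ row , deleteRow-S B i′ row)
  where B = S₀ 0# _≟_ Q
... | inj₂ (j′ , col) =
  inj₂ (j′ , colGreens B (plainS₀ 0# _≟_ Q) j′ col , deleteCol-S B j′ col)
  where B = S₀ 0# _≟_ Q
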